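{- Let $A=\{a_1,\dots,a_r\}\in\binom{[n]}{r}$ and $\mathcal{A}=F(r,n,\{A\})$. Then $\mathcal{A}$ is intersecting if and only if $A\prec[s,2s-1]$ for some $s$ with $1\le s\le r$.
   Context: $[a,b]=\{a,\dots,b\}$, $[n]=[1,n]$; $\binom{[n]}{r}$ is the set of $r$-subsets of $[n]$ listed increasingly. For $A=\{a_1<\dots<a_r\}$ and $C=\{c_1<\dots<c_k\}$, write $A\prec C$ if $r\ge k$ and $a_i\le c_i$ for $1\le i\le k$. For $\mathcal{G}\subseteq2^{[n]}$, $F(r,n,\mathcal{G})=\{B\in\binom{[n]}{r}:B\prec G\text{ for some }G\in\mathcal{G}\}$. A family is intersecting if any two of its members intersect. -}

module Defs where

open import Data.Nat using (ℕ; _≤_; _<_)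
open import Data.List using (List; []; _∷_; length; applyUpTo)
open import Data.List.Relation.Unary.All using (All)
open import Data.List.Relation.Unary.Linked using (Linked)
open import Data.List.Membership.Propositional using (_∈_)
open import Data.Product using (_×_; ∃-syntax)
open import Data.Unit using (⊤)
open import Data.Empty using (⊥)
open import Relation.Binary.PropositionalEquality using (_≡_)

-- A finite set of naturals is represented by the list of its elements in
-- strictly increasing order.

IsRSubset : ℕ → ℕ → List ℕ → Set
IsRSubset r n B = (length B ≡ r) × Linked _<_ B × All (λ x → 1 ≤ x × x ≤ n) B

_≺_ : List ℕ → List ℕ → Set
_ ≺ [] = ⊤
[] ≺ (_ ∷ _) = ⊥
(a ∷ A) ≺ (c ∷ C) = (a ≤ c) × (A ≺ C)

Family : Set₁
Family = List ℕ → Set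

F₁ : ℕ → ℕ → List ℕ → Family
F₁ r n A B = IsRSubset r n B × (B ≺ A)

Intersecting : Family → Set
Intersecting 𝒜 = ∀ B C → 𝒜 B → 𝒜 C → ∃[ x ] (x ∈ B × x ∈ C)

interval : ℕ → List ℕ
interval s = applyUpTo (s +_) s
  where open import Data.Nat using (_+_)

module Submission where

-- If A ≺ [s, 2s−1], the first s elements of any two members B, C of the family
-- are 2s numbers in [1, 2s−1], so by pigeonhole B and C share one. Conversely,
-- if a_{i+1} ≥ 2i+2 for every 0 ≤ i < r, both the odd numbers 1, 3, 5, … and
-- the even numbers 2, 4, 6, … (first r of each) lie below A, giving two disjoint
-- members; otherwise a_{i+1} ≤ 2i+1 for some i, and since A is strictly
-- increasing this bound propagates down to A ≺ [i+1, 2i+1].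

open import Defs
open import Data.Nat using (ℕ; suc; _+_; _*_; _∸_; _≤_; _<_; z≤n; s≤s; _≤?_)
open import Data.Nat.Properties
  using (≤-trans; ≤-pred; ≤-reflexive; <-trans; <-cmp; <⇒≱; ≰⇒>; ≤-<-trans; <-≤-trans; n<1+n;
         suc-injective; +-suc; +-identityʳ; +-monoʳ-≤; +-monoʳ-<; *-monoʳ-<; ∸-monoʳ-<; even≢odd)
open import Data.List using (List; []; _∷_; length; applyUpTo; lookup; take)
open import Data.List.Properties using (length-applyUpTo)
open import Data.List.Relation.Unary.All as All using (All; []; _∷_)
open import Data.List.Relation.Unary.All.Properties using (applyUpTo⁺₁; applyUpTo⁺₂)
import Data.List.Relation.Unary.AllPairs.Properties as AllPairs
open import Data.List.Relation.Unary.Any using (here; there)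
open import Data.List.Relation.Unary.Linked using (Linked; []; [-]; _∷_)
open import Data.List.Relation.Unary.Linked.Properties
  using (AllPairs⇒Linked; Linked⇒AllPairs)
  renaming (applyUpTo⁺₂ to Linked-applyUpTo⁺₂)
open import Data.List.Membership.Propositional using (_∈_)
open import Data.List.Membership.Propositional.Properties using (∈-applyUpTo⁻)
open import Data.List.Relation.Binary.Sublist.Propositional using () renaming (lookup to ⊆-lookup)
open import Data.List.Relation.Binary.Sublist.Propositional.Properties using (take-⊆)
open import Data.Fin using (Fin; zero; suc; toℕ)
open import Data.Fin.Properties using (all?; ¬∀⟶∃¬; toℕ<n)
open import Data.Product using (_×_; ∃-syntax; _,_; proj₁; proj₂)
open import Data.Unit using (tt)
open import Data.Empty using (⊥-elim)
open import Function using (_∘_)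
open import Function.Bundles using (_⇔_; mk⇔)
open import Relation.Nullary using (¬_; yes; no)
open import Relation.Binary.Definitions using (Tri; tri<; tri≈; tri>)
open import Relation.Binary.PropositionalEquality using (_≡_; refl; sym; trans; cong; cong₂; subst)

≺-trans : ∀ B A C → B ≺ A → A ≺ C → B ≺ C
≺-trans B A [] _ _ = tt
≺-trans (b ∷ B) (a ∷ A) (c ∷ C) (b≤a , B≺A) (a≤c , A≺C) =
  ≤-trans b≤a a≤c , ≺-trans B A C B≺A A≺C

take-≺ : ∀ B C → B ≺ C → take (length C) B ≺ C
take-≺ B [] _ = tt
take-≺ (b ∷ B) (c ∷ C) (b≤c , B≺C) = b≤c , take-≺ B C B≺C

length-take-≺ : ∀ B C → B ≺ C → length (take (length C) B) ≡ length C
length-take-≺ B [] _ = refl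
length-take-≺ (b ∷ B) (c ∷ C) (_ , B≺C) = cong suc (length-take-≺ B C B≺C)

≺-All≤ : ∀ {h} B C → length B ≡ length C → B ≺ C → All (_≤ h) C → All (_≤ h) B
≺-All≤ [] _ _ _ _ = []
≺-All≤ (b ∷ B) (c ∷ C) |B|≡|C| (b≤c , B≺C) (c≤h ∷ C≤h) =
  ≤-trans b≤c c≤h ∷ ≺-All≤ B C (suc-injective |B|≡|C|) B≺C C≤h

applyUpTo-≺ : ∀ (f : ℕ → ℕ) A → (∀ i → f (toℕ i) ≤ lookup A i) → applyUpTo f (length A) ≺ A
applyUpTo-≺ f [] _ = tt
applyUpTo-≺ f (a ∷ A) f≤A = f≤A zero , applyUpTo-≺ (f ∘ suc) A (f≤A ∘ suc)

-- A increases by at least 1 per step and f by at most 1, so the bound at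
-- index i propagates down to every j ≤ i.
≺-applyUpTo : ∀ (f : ℕ → ℕ) A → (∀ j → f (suc j) ≤ suc (f j)) → Linked _<_ A →
              (i : Fin (length A)) → lookup A i ≤ f (toℕ i) → A ≺ applyUpTo f (suc (toℕ i))
≺-applyUpTo f (a ∷ A) _ _ zero a≤f0 = a≤f0 , tt
≺-applyUpTo f (a ∷ b ∷ A) f-slow (a<b ∷ b↗) (suc i) Ai≤fi =
  ≤-pred (≤-trans a<b (≤-trans (proj₁ rest) (f-slow 0))) , rest
  where rest = ≺-applyUpTo (f ∘ suc) (b ∷ A) (f-slow ∘ suc) b↗ i Ai≤fi

Linked-∷⁺ : ∀ {x xs} → All (x <_) xs → Linked _<_ xs → Linked _<_ (x ∷ xs)
Linked-∷⁺ [] [] = [-]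
Linked-∷⁺ (x<y ∷ _) y↗ = x<y ∷ y↗

Linked-take⁺ : ∀ {xs} k → Linked _<_ xs → Linked _<_ (take k xs)
Linked-take⁺ k = AllPairs⇒Linked ∘ AllPairs.take⁺ k ∘ Linked⇒AllPairs <-trans

length≤∸ : ∀ {lo hi} X → Linked _<_ (lo ∷ X) → All (_≤ hi) X → length X ≤ hi ∸ lo
length≤∸ [] _ _ = z≤n
length≤∸ (x ∷ X) (lo<x ∷ x↗) (x≤hi ∷ X≤hi) =
  ≤-<-trans (length≤∸ X x↗ X≤hi) (∸-monoʳ-< lo<x x≤hi)

∸-shrink : ∀ {lo m hi k} → lo < m → m ≤ hi → hi ∸ lo < suc k → hi ∸ m < k
∸-shrink lo<m m≤hi room = <-≤-trans (∸-monoʳ-< lo<m m≤hi) (≤-pred room)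

-- Linked _<_ (lo ∷ X) says that X is strictly increasing with entries above lo.
-- The two lists are merged from the bottom; each discarded head uses up one of
-- the hi ∸ lo slots of (lo, hi].
pigeonhole : ∀ {lo hi} X Y → Linked _<_ (lo ∷ X) → Linked _<_ (lo ∷ Y) →
             All (_≤ hi) X → All (_≤ hi) Y → hi ∸ lo < length X + length Y →
             ∃[ z ] (z ∈ X × z ∈ Y)
pigeonhole [] Y _ Y↗ _ Y≤hi room = ⊥-elim (<⇒≱ room (length≤∸ Y Y↗ Y≤hi))
pigeonhole {lo} {hi} (x ∷ X) [] X↗ _ X≤hi _ room =
  ⊥-elim (<⇒≱ (subst (hi ∸ lo <_) (+-identityʳ _) room) (length≤∸ (x ∷ X) X↗ X≤hi))
pigeonhole (x ∷ X) (y ∷ Y) X↗ Y↗ X≤hi Y≤hi room = merge (<-cmp x y) X↗ Y↗ X≤hi Y≤hi room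
  where
  merge : ∀ {lo hi} → Tri (x < y) (x ≡ y) (y < x) →
          Linked _<_ (lo ∷ x ∷ X) → Linked _<_ (lo ∷ y ∷ Y) →
          All (_≤ hi) (x ∷ X) → All (_≤ hi) (y ∷ Y) →
          hi ∸ lo < length (x ∷ X) + length (y ∷ Y) →
          ∃[ z ] (z ∈ x ∷ X × z ∈ y ∷ Y)
  merge (tri≈ _ x≡y _) _ _ _ _ _ = x , here refl , here x≡y
  merge (tri< x<y _ _) (lo<x ∷ x↗) (_ ∷ y↗) (x≤hi ∷ X≤hi) Y≤hi room =
    let z , z∈X , z∈Y = pigeonhole X (y ∷ Y) x↗ (x<y ∷ y↗) X≤hi Y≤hi (∸-shrink lo<x x≤hi room)
    in z , there z∈X , z∈Y
  merge {lo} {hi} (tri> _ _ y<x) (_ ∷ x↗) (lo<y ∷ y↗) X≤hi (y≤hi ∷ Y≤hi) room =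
    let z , z∈X , z∈Y = pigeonhole (x ∷ X) Y (y<x ∷ x↗) y↗ X≤hi Y≤hi
                          (∸-shrink lo<y y≤hi
                                    (subst (hi ∸ lo <_) (+-suc (length (x ∷ X)) (length Y)) room))
    in z , z∈X , there z∈Y

≺-common-element : ∀ {lo hi} C D E → Linked _<_ (lo ∷ D) → Linked _<_ (lo ∷ E) →
                   D ≺ C → E ≺ C → All (_≤ hi) C → hi ∸ lo < length C + length C →
                   ∃[ z ] (z ∈ D × z ∈ E)
≺-common-element {lo} {hi} C D E D↗ E↗ D≺C E≺C C≤hi room =
  let z , z∈D′ , z∈E′ = pigeonhole (take k D) (take k E)
                          (Linked-take⁺ (suc k) D↗) (Linked-take⁺ (suc k) E↗)
                          (≺-All≤ _ C (length-take-≺ D C D≺C) (take-≺ D C D≺C) C≤hi)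
                          (≺-All≤ _ C (length-take-≺ E C E≺C) (take-≺ E C E≺C) C≤hi)
                          (subst (hi ∸ lo <_)
                                 (sym (cong₂ _+_ (length-take-≺ D C D≺C) (length-take-≺ E C E≺C))) room)
  in z , ⊆-lookup (take-⊆ k D) z∈D′ , ⊆-lookup (take-⊆ k E) z∈E′
  where k = length C

odds evens : ℕ → List ℕ
odds  = applyUpTo (λ i → suc (2 * i))
evens = applyUpTo (λ i → 2 * suc i)

odds-evens-disjoint : ∀ {r} → ¬ (∃[ z ] (z ∈ odds r × z ∈ evens r))
odds-evens-disjoint (_ , z∈odds , z∈evens)
  with i , _ , refl ← ∈-applyUpTo⁻ _ z∈odds | j , _ , odd≡even ← ∈-applyUpTo⁻ _ z∈evens =
  even≢odd (suc j) i (sym odd≡even)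

applyUpTo∈F₁ : ∀ {n} (f : ℕ → ℕ) A → All (_≤ n) A →
               (∀ i → f i < f (suc i)) → (∀ i → 1 ≤ f i) → applyUpTo f (length A) ≺ A →
               F₁ (length A) n A (applyUpTo f (length A))
applyUpTo∈F₁ f A A≤n f↗ f≥1 f≺A =
  ( length-applyUpTo f (length A)
  , Linked-applyUpTo⁺₂ f (length A) f↗
  , All.zip ( applyUpTo⁺₂ f (length A) f≥1
            , ≺-All≤ _ A (length-applyUpTo f (length A)) f≺A A≤n))
  , f≺A

2*[1+n]≡1+[1+n]+n : ∀ n → 2 * suc n ≡ suc (suc n + n)
2*[1+n]≡1+[1+n]+n n = trans (cong (suc n +_) (+-identityʳ (suc n))) (+-suc (suc n) n)

intersecting⇒≺interval : ∀ {n} A → IsRSubset (length A) n A →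
                         Intersecting (F₁ (length A) n A) →
                         ∃[ s ] (1 ≤ s × s ≤ length A × A ≺ interval s)
intersecting⇒≺interval {n} A (_ , A↗ , A∈[n]) intersecting
  with all? (λ i → 2 * suc (toℕ i) ≤? lookup A i)
... | yes evens≤A = ⊥-elim (odds-evens-disjoint (intersecting _ _ odds∈F₁ evens∈F₁))
  where
  A≤n : All (_≤ n) A
  A≤n = All.map proj₂ A∈[n]
  odds≤A : ∀ i → suc (2 * toℕ i) ≤ lookup A i
  odds≤A i = ≤-trans (*-monoʳ-< 2 (n<1+n (toℕ i))) (evens≤A i)
  odds∈F₁ : F₁ (length A) n A (odds (length A))
  odds∈F₁ = applyUpTo∈F₁ _ A A≤n (λ i → s≤s (*-monoʳ-< 2 (n<1+n i))) (λ _ → s≤s z≤n)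
                           (applyUpTo-≺ _ A odds≤A)
  evens∈F₁ : F₁ (length A) n A (evens (length A))
  evens∈F₁ = applyUpTo∈F₁ _ A A≤n (λ i → *-monoʳ-< 2 (n<1+n (suc i))) (λ _ → s≤s z≤n)
                            (applyUpTo-≺ _ A evens≤A)
... | no ¬evens≤A with i , Ai≱ ← ¬∀⟶∃¬ _ _ (λ i → 2 * suc (toℕ i) ≤? lookup A i) ¬evens≤A =
  suc (toℕ i) , s≤s z≤n , toℕ<n i ,
  ≺-applyUpTo (suc (toℕ i) +_) A (λ j → ≤-reflexive (+-suc (suc (toℕ i)) j)) A↗ i
    (≤-pred (subst (lookup A i <_) (2*[1+n]≡1+[1+n]+n (toℕ i)) (≰⇒> Ai≱)))

≺interval⇒intersecting : ∀ {n r s} A → 1 ≤ s → A ≺ interval s → Intersecting (F₁ r n A)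
≺interval⇒intersecting {s = suc t} A _ A≺I B C
                       ((_ , B↗ , B∈[n]) , B≺A) ((_ , C↗ , C∈[n]) , C≺A) =
  ≺-common-element {0} {suc t + t} (interval (suc t)) B C
    (Linked-∷⁺ (All.map proj₁ B∈[n]) B↗) (Linked-∷⁺ (All.map proj₁ C∈[n]) C↗)
    (≺-trans B A _ B≺A A≺I) (≺-trans C A _ C≺A A≺I)
    (applyUpTo⁺₁ (suc t +_) (suc t) (+-monoʳ-≤ (suc t) ∘ ≤-pred))
    (subst (suc t + t <_) (sym (cong₂ _+_ |I| |I|)) (+-monoʳ-< (suc t) (n<1+n t)))
  where |I| = length-applyUpTo (suc t +_) (suc t)

lemma8 : (n r : ℕ) (A : List ℕ) → IsRSubset r n A →
    Intersecting (F₁ r n A) ⇔ (∃[ s ] (1 ≤ s × s ≤ r × A ≺ interval s))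
lemma8 n .(length A) A A-is-subset@(refl , _ , _) =
  mk⇔ (intersecting⇒≺interval A A-is-subset)
      (λ (s , 1≤s , _ , A≺I) → ≺interval⇒intersecting A 1≤s A≺I)
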